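{- (i) For every $e\geq 0$ and every $n$ with $2^{e+2}\leq n\leq 2^{e+3}-2^e$, $$s(n)=-s(n-2^e)+s(n-2\cdot 2^e)+2s(n-3\cdot 2^e).$$ (ii) For every $e\geq 0$ and every $n$ with $2^{e+2}\leq n\leq 2^{e+3}$, $$t(n)=t(n-2^e)-t(n-2^{e+1}).$$
   Context: The Stern sequence $s$ is defined by $s(0)=0$, $s(1)=1$, $s(2n)=s(n)$, $s(2n+1)=s(n)+s(n+1)$ for $n\geq1$. The twisted Stern sequence $t$ is defined by $t(0)=0$, $t(1)=1$, $t(2n)=-t(n)$, $t(2n+1)=-t(n)-t(n+1)$ for $n\geq 1$. -}

module Defs where

open import Data.Nat using (ℕ; zero; suc; _+_; _*_)
open import Data.Nat.DivMod using (_/_; _%_)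
open import Data.Integer as ℤ using (ℤ; +_; -_)

-- Stern sequence, computed with fuel (fuel ≥ n suffices, since n/2 < n).
-- sF f n : fuel f; s(0)=0, s(1)=1, s(2m)=s(m), s(2m+1)=s(m)+s(m+1).
sF : ℕ → ℕ → ℕ
sF _ zero = 0
sF _ (suc zero) = 1
sF zero (suc (suc n)) = 0
sF (suc f) (suc (suc n)) with (suc (suc n)) % 2
... | zero = sF f ((suc (suc n)) / 2)
... | suc _ = sF f ((suc (suc n)) / 2) + sF f (suc ((suc (suc n)) / 2))

stern : ℕ → ℕ
stern n = sF n n

tF : ℕ → ℕ → ℤ
tF _ zero = + 0
tF _ (suc zero) = + 1
tF zero (suc (suc n)) = + 0
tF (suc f) (suc (suc n)) with (suc (suc n)) % 2
... | zero = - tF f ((suc (suc n)) / 2)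
... | suc _ = (- tF f ((suc (suc n)) / 2)) ℤ.- tF f (suc ((suc (suc n)) / 2))

twisted : ℕ → ℤ
twisted n = tF n n

-- Both sequences satisfy f(2m) = ε f(m) and f(2m+1) = ε (f(m) + f(m+1)) for m ≥ 1, with
-- ε = 1 for s and ε = −1 for t.  Hence if a fixed combination c₁ f(p+k) + … + c₄ f(4p+k)
-- vanishes for all 0 ≤ k ≤ Lp, it also vanishes at scale 2p for all 0 ≤ k ≤ 2Lp: an even
-- offset 2j gives ε times the combination at (p, j), an odd offset 2j+1 gives ε times the sum
-- of the combinations at (p, j) and (p, j+1).  With p = 2^e and n = 4p + k, identity (i) is
-- the vanishing of the combination (−2, −1, 1, 1) of s for k ≤ 3p and (ii) that of (0, 1, −1, 1)
-- of t for k ≤ 4p, so each is a finite check at p = 1 followed by induction on e.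
module Submission where

open import Defs
open import Data.Nat using (ℕ; _∸_; _^_; _≤_; _*_)
open import Data.Integer using (ℤ; +_; -_; _+_; _-_)
open import Data.Product using (_×_)
open import Relation.Binary.PropositionalEquality using (_≡_)

open import Function using (_∘_)
open import Data.Nat as ℕ using (zero; suc; z≤n; s≤s)
import Data.Nat.Properties as ℕP
open import Data.Nat.DivMod using (_/_; _%_; m*n%n≡0; m*n/n≡m; [m+kn]%n≡m%n; +-distrib-/)
open import Data.Product using (∃; _,_)
import Data.Integer as ℤ
import Data.Integer.Properties as ℤP
open import Relation.Binary.PropositionalEquality
  using (refl; sym; trans; cong; cong₂; subst; subst₂; module ≡-Reasoning)
import Data.Nat.Tactic.RingSolver as ℕSolver
import Data.Integer.Tactic.RingSolver as ℤSolver

data Parity : ℕ → Set where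
  even : ∀ m → Parity (m ℕ.+ m)
  odd  : ∀ m → Parity (suc (m ℕ.+ m))

parity : ∀ n → Parity n
parity zero = even 0
parity (suc n) with parity n
... | even m = odd m
... | odd m  = subst Parity (cong suc (ℕP.+-suc m m)) (even (suc m))

half-≤ : ∀ {j x} → j ℕ.+ j ≤ x ℕ.+ x → j ≤ x
half-≤ h = ℕP.≮⇒≥ λ x<j → ℕP.<⇒≱ (ℕP.+-mono-< x<j x<j) h

half-< : ∀ {j x} → suc (j ℕ.+ j) ≤ x ℕ.+ x → suc j ≤ x
half-< h = ℕP.≰⇒> λ x≤j → ℕP.<⇒≱ h (ℕP.+-mono-≤ x≤j x≤j)

private
  2+2m≡[1+m]*2 : ∀ m → suc (suc (m ℕ.+ m)) ≡ suc m * 2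
  2+2m≡[1+m]*2 = ℕSolver.solve-∀

  3+2m≡1+[1+m]*2 : ∀ m → suc (suc (suc (m ℕ.+ m))) ≡ 1 ℕ.+ suc m * 2
  3+2m≡1+[1+m]*2 = ℕSolver.solve-∀

  2+2m%2≡0 : ∀ m → suc (suc (m ℕ.+ m)) % 2 ≡ 0
  2+2m%2≡0 m = trans (cong (_% 2) (2+2m≡[1+m]*2 m)) (m*n%n≡0 (suc m) 2)

  2+2m/2≡1+m : ∀ m → suc (suc (m ℕ.+ m)) / 2 ≡ suc m
  2+2m/2≡1+m m = trans (cong (_/ 2) (2+2m≡[1+m]*2 m)) (m*n/n≡m (suc m) 2)

  3+2m%2≡1 : ∀ m → suc (suc (suc (m ℕ.+ m))) % 2 ≡ 1
  3+2m%2≡1 m = trans (cong (_% 2) (3+2m≡1+[1+m]*2 m)) ([m+kn]%n≡m%n 1 (suc m) 2)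

  3+2m/2≡1+m : ∀ m → suc (suc (suc (m ℕ.+ m))) / 2 ≡ suc m
  3+2m/2≡1+m m = begin
    suc (suc (suc (m ℕ.+ m))) / 2 ≡⟨ cong (_/ 2) (3+2m≡1+[1+m]*2 m) ⟩
    (1 ℕ.+ suc m * 2) / 2         ≡⟨ +-distrib-/ 1 (suc m * 2) 1+[1+m]*2%2<2 ⟩
    0 ℕ.+ suc m * 2 / 2           ≡⟨ m*n/n≡m (suc m) 2 ⟩
    suc m                         ∎
    where
    open ≡-Reasoning
    1+[1+m]*2%2<2 : 1 ℕ.+ suc m * 2 % 2 ℕ.< 2
    1+[1+m]*2%2<2 = subst (λ r → 1 ℕ.+ r ℕ.< 2) (sym (m*n%n≡0 (suc m) 2)) (s≤s (s≤s z≤n))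

sF-even : ∀ f m → sF (suc f) (suc (suc (m ℕ.+ m))) ≡ sF f (suc m)
sF-even f m rewrite 2+2m%2≡0 m | 2+2m/2≡1+m m = refl

sF-odd : ∀ f m → sF (suc f) (suc (suc (suc (m ℕ.+ m)))) ≡ sF f (suc m) ℕ.+ sF f (suc (suc m))
sF-odd f m rewrite 3+2m%2≡1 m | 3+2m/2≡1+m m = refl

tF-even : ∀ f m → tF (suc f) (suc (suc (m ℕ.+ m))) ≡ - tF f (suc m)
tF-even f m rewrite 2+2m%2≡0 m | 2+2m/2≡1+m m = refl

tF-odd : ∀ f m → tF (suc f) (suc (suc (suc (m ℕ.+ m)))) ≡ (- tF f (suc m)) - tF f (suc (suc m))
tF-odd f m rewrite 3+2m%2≡1 m | 3+2m/2≡1+m m = refl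

1+m≤1+2m : ∀ m → suc m ≤ suc (m ℕ.+ m)
1+m≤1+2m m = s≤s (ℕP.m≤m+n m m)

sF-fuel : ∀ {f g} n → n ≤ f → n ≤ g → sF f n ≡ sF g n
sF-fuel zero _ _ = refl
sF-fuel (suc zero) _ _ = refl
sF-fuel {suc f} {suc g} (suc (suc k)) (s≤s n≤f) (s≤s n≤g) with parity k
... | even m rewrite sF-even f m | sF-even g m =
  sF-fuel (suc m) (ℕP.≤-trans (1+m≤1+2m m) n≤f) (ℕP.≤-trans (1+m≤1+2m m) n≤g)
... | odd m rewrite sF-odd f m | sF-odd g m =
  cong₂ ℕ._+_
    (sF-fuel (suc m) (ℕP.≤-trans (ℕP.m≤n⇒m≤1+n (1+m≤1+2m m)) n≤f)
                     (ℕP.≤-trans (ℕP.m≤n⇒m≤1+n (1+m≤1+2m m)) n≤g))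
    (sF-fuel (suc (suc m)) (ℕP.≤-trans (s≤s (1+m≤1+2m m)) n≤f)
                           (ℕP.≤-trans (s≤s (1+m≤1+2m m)) n≤g))

tF-fuel : ∀ {f g} n → n ≤ f → n ≤ g → tF f n ≡ tF g n
tF-fuel zero _ _ = refl
tF-fuel (suc zero) _ _ = refl
tF-fuel {suc f} {suc g} (suc (suc k)) (s≤s n≤f) (s≤s n≤g) with parity k
... | even m rewrite tF-even f m | tF-even g m =
  cong -_ (tF-fuel (suc m) (ℕP.≤-trans (1+m≤1+2m m) n≤f) (ℕP.≤-trans (1+m≤1+2m m) n≤g))
... | odd m rewrite tF-odd f m | tF-odd g m =
  cong₂ _-_
    (cong -_ (tF-fuel (suc m) (ℕP.≤-trans (ℕP.m≤n⇒m≤1+n (1+m≤1+2m m)) n≤f)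
                              (ℕP.≤-trans (ℕP.m≤n⇒m≤1+n (1+m≤1+2m m)) n≤g)))
    (tF-fuel (suc (suc m)) (ℕP.≤-trans (s≤s (1+m≤1+2m m)) n≤f)
                           (ℕP.≤-trans (s≤s (1+m≤1+2m m)) n≤g))

stern-double : ∀ m → stern (m ℕ.+ m) ≡ stern m
stern-double zero = refl
stern-double (suc m) rewrite ℕP.+-suc m m =
  trans (sF-even _ m) (sF-fuel (suc m) (1+m≤1+2m m) ℕP.≤-refl)

stern-double+1 : ∀ m → stern (suc (m ℕ.+ m)) ≡ stern m ℕ.+ stern (suc m)
stern-double+1 zero = refl
stern-double+1 (suc m) rewrite ℕP.+-suc m m =
  trans (sF-odd _ m)
        (cong₂ ℕ._+_ (sF-fuel (suc m) (ℕP.m≤n⇒m≤1+n (1+m≤1+2m m)) ℕP.≤-refl)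
                     (sF-fuel (suc (suc m)) (s≤s (1+m≤1+2m m)) ℕP.≤-refl))

twisted-double : ∀ m → twisted (m ℕ.+ m) ≡ - twisted m
twisted-double zero = refl
twisted-double (suc m) rewrite ℕP.+-suc m m =
  trans (tF-even _ m) (cong -_ (tF-fuel (suc m) (1+m≤1+2m m) ℕP.≤-refl))

-- Fails at m = 0, since t(1) = 1 ≠ −t(0) − t(1).
twisted-double+1 : ∀ m → twisted (suc (suc m ℕ.+ suc m)) ≡ (- twisted (suc m)) - twisted (suc (suc m))
twisted-double+1 m rewrite ℕP.+-suc m m =
  trans (tF-odd _ m)
        (cong₂ _-_ (cong -_ (tF-fuel (suc m) (ℕP.m≤n⇒m≤1+n (1+m≤1+2m m)) ℕP.≤-refl))
                   (tF-fuel (suc (suc m)) (s≤s (1+m≤1+2m m)) ℕP.≤-refl))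

record SternLike (ε : ℤ) (f : ℕ → ℤ) : Set where
  field
    double   : ∀ m → f (m ℕ.+ m) ≡ ε ℤ.* f m
    double+1 : ∀ m → f (suc (suc m ℕ.+ suc m)) ≡ ε ℤ.* (f (suc m) + f (suc (suc m)))

stern-sternLike : SternLike ℤ.1ℤ (+_ ∘ stern)
stern-sternLike = record
  { double   = λ m → trans (cong +_ (stern-double m)) (sym (ℤP.*-identityˡ _))
  ; double+1 = λ m → trans (cong +_ (stern-double+1 (suc m)))
                           (trans (ℤP.pos-+ (stern (suc m)) (stern (suc (suc m))))
                                  (sym (ℤP.*-identityˡ _)))
  }

twisted-sternLike : SternLike ℤ.-1ℤ twisted
twisted-sternLike = record
  { double   = λ m → trans (twisted-double m) (sym (ℤP.-1*i≡-i _))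
  ; double+1 = λ m → trans (twisted-double+1 m) (-x-y≡-1*[x+y] (twisted (suc m)) (twisted (suc (suc m))))
  }
  where
  -x-y≡-1*[x+y] : ∀ x y → (- x) - y ≡ ℤ.-1ℤ ℤ.* (x + y)
  -x-y≡-1*[x+y] = ℤSolver.solve-∀

record Coefficients : Set where
  constructor coefficients
  field c₁ c₂ c₃ c₄ : ℤ

combination : Coefficients → (ℕ → ℤ) → ℕ → ℕ → ℤ
combination (coefficients c₁ c₂ c₃ c₄) f p k =
  c₁ ℤ.* f (1 * p ℕ.+ k) + c₂ ℤ.* f (2 * p ℕ.+ k) + c₃ ℤ.* f (3 * p ℕ.+ k) + c₄ ℤ.* f (4 * p ℕ.+ k)

Vanishes : Coefficients → (ℕ → ℤ) → ℕ → ℕ → Set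
Vanishes c f L p = ∀ k → k ≤ L * p → combination c f p k ≡ + 0

module _ {ε : ℤ} {f : ℕ → ℤ} (sternLike : SternLike ε f) where
  open SternLike sternLike

  at-double : ∀ a p j → f (a * (p ℕ.+ p) ℕ.+ (j ℕ.+ j)) ≡ ε ℤ.* f (a * p ℕ.+ j)
  at-double a p j = trans (cong f (a[p+p]+[j+j] a p j)) (double (a * p ℕ.+ j))
    where
    a[p+p]+[j+j] : ∀ a p j → a * (p ℕ.+ p) ℕ.+ (j ℕ.+ j) ≡ (a * p ℕ.+ j) ℕ.+ (a * p ℕ.+ j)
    a[p+p]+[j+j] = ℕSolver.solve-∀

  at-double+1 : ∀ a p j → f (suc a * (suc p ℕ.+ suc p) ℕ.+ suc (j ℕ.+ j))
                        ≡ ε ℤ.* (f (suc a * suc p ℕ.+ j) + f (suc a * suc p ℕ.+ suc j))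
  at-double+1 a p j = begin
    f (suc a * (suc p ℕ.+ suc p) ℕ.+ suc (j ℕ.+ j))
      ≡⟨ cong f (a[p+p]+[1+j+j] a p j) ⟩
    f (suc (suc m ℕ.+ suc m))
      ≡⟨ double+1 m ⟩
    ε ℤ.* (f (suc m) + f (suc (suc m)))
      ≡⟨ cong (λ x → ε ℤ.* (f (suc m) + f x)) (sym (ℕP.+-suc (suc a * suc p) j)) ⟩
    ε ℤ.* (f (suc a * suc p ℕ.+ j) + f (suc a * suc p ℕ.+ suc j)) ∎
    where
    open ≡-Reasoning
    m = p ℕ.+ a * suc p ℕ.+ j
    a[p+p]+[1+j+j] : ∀ a p j → suc a * (suc p ℕ.+ suc p) ℕ.+ suc (j ℕ.+ j)
                   ≡ suc (suc (p ℕ.+ a * suc p ℕ.+ j) ℕ.+ suc (p ℕ.+ a * suc p ℕ.+ j))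
    a[p+p]+[1+j+j] = ℕSolver.solve-∀

  combination-even : ∀ c p j → combination c f (p ℕ.+ p) (j ℕ.+ j) ≡ ε ℤ.* combination c f p j
  combination-even (coefficients c₁ c₂ c₃ c₄) p j
    rewrite at-double 1 p j | at-double 2 p j | at-double 3 p j | at-double 4 p j =
    distrib ε c₁ c₂ c₃ c₄ (f (1 * p ℕ.+ j)) (f (2 * p ℕ.+ j)) (f (3 * p ℕ.+ j)) (f (4 * p ℕ.+ j))
    where
    distrib : ∀ ε c₁ c₂ c₃ c₄ x₁ x₂ x₃ x₄ →
      c₁ ℤ.* (ε ℤ.* x₁) + c₂ ℤ.* (ε ℤ.* x₂) + c₃ ℤ.* (ε ℤ.* x₃) + c₄ ℤ.* (ε ℤ.* x₄)
      ≡ ε ℤ.* (c₁ ℤ.* x₁ + c₂ ℤ.* x₂ + c₃ ℤ.* x₃ + c₄ ℤ.* x₄)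
    distrib = ℤSolver.solve-∀

  combination-odd : ∀ c p j → combination c f (suc p ℕ.+ suc p) (suc (j ℕ.+ j))
                  ≡ ε ℤ.* (combination c f (suc p) j + combination c f (suc p) (suc j))
  combination-odd (coefficients c₁ c₂ c₃ c₄) p j
    rewrite at-double+1 0 p j | at-double+1 1 p j | at-double+1 2 p j | at-double+1 3 p j =
    distrib ε c₁ c₂ c₃ c₄ (f (1 * suc p ℕ.+ j)) (f (2 * suc p ℕ.+ j)) (f (3 * suc p ℕ.+ j)) (f (4 * suc p ℕ.+ j))
            (f (1 * suc p ℕ.+ suc j)) (f (2 * suc p ℕ.+ suc j)) (f (3 * suc p ℕ.+ suc j)) (f (4 * suc p ℕ.+ suc j))
    where
    distrib : ∀ ε c₁ c₂ c₃ c₄ x₁ x₂ x₃ x₄ y₁ y₂ y₃ y₄ →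
      c₁ ℤ.* (ε ℤ.* (x₁ + y₁)) + c₂ ℤ.* (ε ℤ.* (x₂ + y₂)) + c₃ ℤ.* (ε ℤ.* (x₃ + y₃)) + c₄ ℤ.* (ε ℤ.* (x₄ + y₄))
      ≡ ε ℤ.* ((c₁ ℤ.* x₁ + c₂ ℤ.* x₂ + c₃ ℤ.* x₃ + c₄ ℤ.* x₄) + (c₁ ℤ.* y₁ + c₂ ℤ.* y₂ + c₃ ℤ.* y₃ + c₄ ℤ.* y₄))
    distrib = ℤSolver.solve-∀

  vanishes-double : ∀ {c L p} → 1 ≤ p → Vanishes c f L p → Vanishes c f L (p ℕ.+ p)
  vanishes-double {c} {L} {suc p} (s≤s z≤n) vanishes k k≤L[p+p]
    with parity k | subst (k ≤_) (ℕP.*-distribˡ-+ L (suc p) (suc p)) k≤L[p+p]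
  ... | even j | j+j≤Lp+Lp = begin
    combination c f (suc p ℕ.+ suc p) (j ℕ.+ j) ≡⟨ combination-even c (suc p) j ⟩
    ε ℤ.* combination c f (suc p) j             ≡⟨ cong (ε ℤ.*_) (vanishes j (half-≤ j+j≤Lp+Lp)) ⟩
    ε ℤ.* + 0                                   ≡⟨ ℤP.*-zeroʳ ε ⟩
    + 0                                         ∎
    where open ≡-Reasoning
  ... | odd j | 1+j+j≤Lp+Lp = begin
    combination c f (suc p ℕ.+ suc p) (suc (j ℕ.+ j))
      ≡⟨ combination-odd c p j ⟩
    ε ℤ.* (combination c f (suc p) j + combination c f (suc p) (suc j))
      ≡⟨ cong₂ (λ x y → ε ℤ.* (x + y)) (vanishes j (ℕP.<⇒≤ j<Lp)) (vanishes (suc j) j<Lp) ⟩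
    ε ℤ.* + 0
      ≡⟨ ℤP.*-zeroʳ ε ⟩
    + 0 ∎
    where
    open ≡-Reasoning
    j<Lp = half-< 1+j+j≤Lp+Lp

  vanishes-pow2 : ∀ {c L} → Vanishes c f L 1 → ∀ e → Vanishes c f L (2 ^ e)
  vanishes-pow2 base zero = base
  vanishes-pow2 {c} {L} base (suc e) =
    subst (Vanishes c f L) (cong (2 ^ e ℕ.+_) (sym (ℕP.+-identityʳ (2 ^ e))))
          (vanishes-double {c} {L} (ℕP.m^n>0 2 e) (vanishes-pow2 {c} {L} base e))

sternCoefficients : Coefficients
sternCoefficients = coefficients (- + 2) (- + 1) (+ 1) (+ 1)

stern-vanishes-base : Vanishes sternCoefficients (+_ ∘ stern) 3 1
stern-vanishes-base 0 _ = refl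
stern-vanishes-base 1 _ = refl
stern-vanishes-base 2 _ = refl
stern-vanishes-base 3 _ = refl
stern-vanishes-base (suc (suc (suc (suc _)))) (s≤s (s≤s (s≤s ())))

twistedCoefficients : Coefficients
twistedCoefficients = coefficients (+ 0) (+ 1) (- + 1) (+ 1)

twisted-vanishes-base : Vanishes twistedCoefficients twisted 4 1
twisted-vanishes-base 0 _ = refl
twisted-vanishes-base 1 _ = refl
twisted-vanishes-base 2 _ = refl
twisted-vanishes-base 3 _ = refl
twisted-vanishes-base 4 _ = refl
twisted-vanishes-base (suc (suc (suc (suc (suc _))))) (s≤s (s≤s (s≤s (s≤s ()))))

2^[e+c]≡2^c*2^e : ∀ e c → 2 ^ (e ℕ.+ c) ≡ 2 ^ c * 2 ^ e
2^[e+c]≡2^c*2^e e c = trans (ℕP.^-distribˡ-+-* 2 e c) (ℕP.*-comm (2 ^ e) (2 ^ c))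

beyond-4p : ∀ L {p n} → 4 * p ≤ n → n ≤ (4 ℕ.+ L) * p → ∃ λ k → k ≤ L * p × n ≡ 4 * p ℕ.+ k
beyond-4p L {p} {n} 4p≤n n≤[4+L]p = n ∸ 4 * p , k≤Lp , sym 4p+k≡n
  where
  4p+k≡n = ℕP.m+[n∸m]≡n 4p≤n
  k≤Lp : n ∸ 4 * p ≤ L * p
  k≤Lp = ℕP.+-cancelˡ-≤ (4 * p) _ _
    (subst₂ _≤_ (sym 4p+k≡n) (ℕP.*-distribʳ-+ p 4 L) n≤[4+L]p)

[a+b]p+k∸ap≡bp+k : ∀ a b p k → (a ℕ.+ b) * p ℕ.+ k ∸ a * p ≡ b * p ℕ.+ k
[a+b]p+k∸ap≡bp+k a b p k =
  trans (cong (_∸ a * p) (shift a b p k)) (ℕP.m+n∸m≡n (a * p) (b * p ℕ.+ k))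
  where
  shift : ∀ a b p k → (a ℕ.+ b) * p ℕ.+ k ≡ a * p ℕ.+ (b * p ℕ.+ k)
  shift = ℕSolver.solve-∀

[1+b]p+k∸p≡bp+k : ∀ b p k → suc b * p ℕ.+ k ∸ p ≡ b * p ℕ.+ k
[1+b]p+k∸p≡bp+k b p k =
  trans (cong (_∸ p) (ℕP.+-assoc p (b * p) k)) (ℕP.m+n∸m≡n p (b * p ℕ.+ k))

2^[e+3]∸2^e≡7*2^e : ∀ e → 2 ^ (e ℕ.+ 3) ∸ 2 ^ e ≡ 7 * 2 ^ e
2^[e+3]∸2^e≡7*2^e e = begin
  2 ^ (e ℕ.+ 3) ∸ 2 ^ e        ≡⟨ cong (_∸ 2 ^ e) (2^[e+c]≡2^c*2^e e 3) ⟩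
  8 * 2 ^ e ∸ 2 ^ e            ≡⟨ cong (_∸ 2 ^ e) (sym (ℕP.+-identityʳ (8 * 2 ^ e))) ⟩
  8 * 2 ^ e ℕ.+ 0 ∸ 2 ^ e      ≡⟨ [1+b]p+k∸p≡bp+k 7 (2 ^ e) 0 ⟩
  7 * 2 ^ e ℕ.+ 0              ≡⟨ ℕP.+-identityʳ (7 * 2 ^ e) ⟩
  7 * 2 ^ e                    ∎
  where open ≡-Reasoning

x≡y+0 : ∀ {x y z} → x ≡ y + z → z ≡ + 0 → x ≡ y
x≡y+0 {y = y} x≡y+z z≡0 = trans x≡y+z (trans (cong (ℤ._+_ y) z≡0) (ℤP.+-identityʳ y))

stern-recurrence : (e n : ℕ) → 2 ^ (e ℕ.+ 2) ≤ n → n ≤ 2 ^ (e ℕ.+ 3) ∸ 2 ^ e →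
  + stern n ≡ (- (+ stern (n ∸ 2 ^ e))) + (+ stern (n ∸ 2 * 2 ^ e)) + + 2 ℤ.* + stern (n ∸ 3 * 2 ^ e)
stern-recurrence e n lo hi
  with beyond-4p 3 {2 ^ e} (subst (_≤ n) (2^[e+c]≡2^c*2^e e 2) lo) (subst (n ≤_) (2^[e+3]∸2^e≡7*2^e e) hi)
... | k , k≤3p , refl
  rewrite [1+b]p+k∸p≡bp+k 3 (2 ^ e) k | [a+b]p+k∸ap≡bp+k 2 2 (2 ^ e) k | [a+b]p+k∸ap≡bp+k 3 1 (2 ^ e) k =
  x≡y+0 (split (s 1) (s 2) (s 3) (s 4))
        (vanishes-pow2 stern-sternLike {sternCoefficients} {3} stern-vanishes-base e k k≤3p)
  where
  s : ℕ → ℤ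
  s a = + stern (a * 2 ^ e ℕ.+ k)
  split : ∀ x₁ x₂ x₃ x₄ →
    x₄ ≡ ((- x₃) + x₂ + + 2 ℤ.* x₁) + (- + 2 ℤ.* x₁ + - + 1 ℤ.* x₂ + + 1 ℤ.* x₃ + + 1 ℤ.* x₄)
  split = ℤSolver.solve-∀

twisted-recurrence : (e n : ℕ) → 2 ^ (e ℕ.+ 2) ≤ n → n ≤ 2 ^ (e ℕ.+ 3) →
  twisted n ≡ twisted (n ∸ 2 ^ e) - twisted (n ∸ 2 ^ (e ℕ.+ 1))
twisted-recurrence e n lo hi
  with beyond-4p 4 {2 ^ e} (subst (_≤ n) (2^[e+c]≡2^c*2^e e 2) lo) (subst (n ≤_) (2^[e+c]≡2^c*2^e e 3) hi)
... | k , k≤4p , refl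
  rewrite [1+b]p+k∸p≡bp+k 3 (2 ^ e) k | 2^[e+c]≡2^c*2^e e 1 | [a+b]p+k∸ap≡bp+k 2 2 (2 ^ e) k =
  x≡y+0 (split (t 1) (t 2) (t 3) (t 4))
        (vanishes-pow2 twisted-sternLike {twistedCoefficients} {4} twisted-vanishes-base e k k≤4p)
  where
  t : ℕ → ℤ
  t a = twisted (a * 2 ^ e ℕ.+ k)
  split : ∀ x₁ x₂ x₃ x₄ →
    x₄ ≡ (x₃ - x₂) + (+ 0 ℤ.* x₁ + + 1 ℤ.* x₂ + - + 1 ℤ.* x₃ + + 1 ℤ.* x₄)
  split = ℤSolver.solve-∀

mainTheorem11 : ((e n : ℕ) → 2 ^ (e Data.Nat.+ 2) ≤ n → n ≤ 2 ^ (e Data.Nat.+ 3) ∸ 2 ^ e →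
    + stern n ≡ (- (+ stern (n ∸ 2 ^ e))) + (+ stern (n ∸ 2 * 2 ^ e)) + + 2 Data.Integer.* + stern (n ∸ 3 * 2 ^ e))
    × ((e n : ℕ) → 2 ^ (e Data.Nat.+ 2) ≤ n → n ≤ 2 ^ (e Data.Nat.+ 3) →
    twisted n ≡ twisted (n ∸ 2 ^ e) - twisted (n ∸ 2 ^ (e Data.Nat.+ 1)))
mainTheorem11 = stern-recurrence , twisted-recurrence
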